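{- There is an absolute constant $C$ with the following property. Let $r$ be a non-negative integer, let $\mathcal{A}$ be an anticode of hexagonal diameter $r$ in the hexagonal grid, let $\ell$ be a positive integer with $\ell\le r$, and let $w$ be the number of hexagonal spheres of radius $\ell$ that intersect $\mathcal{A}$ non-trivially. Then $w\le\frac34(r+2\ell)^2+Cr$.
   Context: Represent the hexagonal grid by $\mathbb{Z}^2$, where $(i,j)$ has neighbours $(i\pm1,j)$, $(i,j\pm1)$, $(i+1,j+1)$, $(i-1,j-1)$ (the adjacency graph of a regular hexagonal tiling). The hexagonal distance is the graph distance in this graph. An anticode of diameter $r$ is a set of grid points with pairwise hexagonal distances at most $r$. A hexagonal sphere of radius $\ell$ is the set of grid points at hexagonal distance at most $\ell$ from a centre grid point. -}

module Defs where

open import Level using (0ℓ)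
open import Data.Nat using (ℕ; suc)
open import Data.Integer using (ℤ; _+_; -_; 1ℤ; 0ℤ)
open import Data.Product using (_×_; _,_; ∃)
open import Relation.Unary using (Pred)

-- Grid points of the hexagonal grid, represented by ℤ².
Point : Set
Point = ℤ × ℤ

data Adj : Point → Point → Set where
  e  : ∀ {i j} → Adj (i , j) (i + 1ℤ , j)
  w  : ∀ {i j} → Adj (i , j) (i + - 1ℤ , j)
  n  : ∀ {i j} → Adj (i , j) (i , j + 1ℤ)
  s  : ∀ {i j} → Adj (i , j) (i , j + - 1ℤ)
  ne : ∀ {i j} → Adj (i , j) (i + 1ℤ , j + 1ℤ)
  sw : ∀ {i j} → Adj (i , j) (i + - 1ℤ , j + - 1ℤ)

data DistLe : ℕ → Point → Point → Set where
  here : ∀ {k p} → DistLe k p p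
  step : ∀ {k p q t} → Adj p q → DistLe k q t → DistLe (suc k) p t

Anticode : ℕ → Pred Point 0ℓ → Set
Anticode r A = ∀ {a b} → A a → A b → DistLe r a b

Sphere : Point → ℕ → Pred Point 0ℓ
Sphere c ℓ p = DistLe ℓ c p

Meets : Pred Point 0ℓ → ℕ → Point → Set
Meets A ℓ c = ∃ λ a → A a × Sphere c ℓ a

module Submission where

-- The coordinates i, j and i − j change by at most 1 along each edge of the grid.
-- Two centres whose spheres meet A are at distance at most ℓ + r + ℓ = D, so all
-- centres lie in a hexagon a ≤ i ≤ a + D, b ≤ j ≤ b + D, c ≤ i − j ≤ c + D.  Column
-- i = a + t of this hexagon has at most D + 1 − |t − o| points for a fixed offset o,
-- and |t − o| + |(D − t) − o| ≥ |2t − D|; pairing column t with column D − t gives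
-- 4 · #hexagon ≤ 4 (D + 1)² − 2 Σₜ |2t − D| ≤ 3D² + 8D + 4.  As D ≤ 3r, C = 7 works.

open import Defs using (Point; Adj; DistLe; Anticode; Meets)
open import Level using (0ℓ)
open import Function using (_∘_)
open import Data.Nat using (ℕ; zero; suc; _+_; _*_; _^_; _∸_; _≤_; _<_; z≤n; s≤s; _≤?_)
open import Data.Nat.Properties
import Data.Nat.Tactic.RingSolver as ℕ-Solver
open import Algebra.Properties.CommutativeSemigroup +-commutativeSemigroup using ()
  renaming (interchange to +-interchange)
open import Data.Integer using (ℤ; +_; -[1+_]; ∣_∣; 0ℤ; 1ℤ; _⊖_; +≤+)
  renaming (_+_ to _+ᶻ_; _-_ to _-ᶻ_; -_ to -ᶻ_; _≤_ to _≤ᶻ_)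
import Data.Integer.Properties as ℤ
open import Data.Integer.Tactic.RingSolver using (solve-∀)
open import Data.Product using (Σ; ∃; _×_; _,_; proj₁; proj₂)
open import Data.Sum using (inj₁; inj₂)
open import Data.List using (List; []; _∷_; length; map; upTo; _++_)
open import Data.List.Properties using (length-map; length-upTo; length-++; length-removeAt′)
open import Data.List.Relation.Unary.All using (All)
import Data.List.Relation.Unary.All as All
open import Data.List.Relation.Unary.Any using (here; there; _─_)
open import Data.List.Relation.Unary.AllPairs using (_∷_)
open import Data.List.Relation.Unary.Unique.Propositional using (Unique)
open import Data.List.Relation.Binary.Subset.Propositional using (_⊆_)
open import Data.List.Membership.Propositional using (_∈_)
open import Data.List.Membership.Propositional.Properties using (∈-map⁺; ∈-upTo⁺; ∈-++⁺ˡ; ∈-++⁺ʳ)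
open import Data.List.Extrema ℤ.≤-totalOrder using (argmin; argmin-all; f[argmin]≤f[⊤]; f[argmin]≤f[xs])
open import Relation.Binary.PropositionalEquality
open import Relation.Nullary using (yes; no; contradiction)
open import Relation.Unary using (Pred)

Near : ℕ → ℤ → ℤ → Set
Near k u v = u ≤ᶻ v +ᶻ + k × v ≤ᶻ u +ᶻ + k

Near-refl : ∀ {k} u → Near k u u
Near-refl {k} u = ℤ.i≤i+j u (+ k) , ℤ.i≤i+j u (+ k)

Near-sym : ∀ {k u v} → Near k u v → Near k v u
Near-sym (u≤v+k , v≤u+k) = v≤u+k , u≤v+k

Near-trans : ∀ {m k u v x} → Near m u v → Near k v x → Near (m + k) u x
Near-trans {m} {k} {u} {v} {x} (u≤v+m , v≤u+m) (v≤x+k , x≤v+k) =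
  subst (λ n → u ≤ᶻ x +ᶻ + n) (+-comm k m) (≤-+-trans {m} {k} {x = x} u≤v+m v≤x+k)
  , ≤-+-trans {k} {m} {x = u} x≤v+k v≤u+m
  where
  ≤-+-trans : ∀ {m k u v x} → u ≤ᶻ v +ᶻ + m → v ≤ᶻ x +ᶻ + k → u ≤ᶻ x +ᶻ + (k + m)
  ≤-+-trans {m} {k} {u} {v} {x} u≤v+m v≤x+k = begin
    u                   ≤⟨ u≤v+m ⟩
    v +ᶻ + m            ≤⟨ ℤ.+-monoˡ-≤ (+ m) v≤x+k ⟩
    x +ᶻ + k +ᶻ + m     ≡⟨ ℤ.+-assoc x (+ k) (+ m) ⟩
    x +ᶻ + (k + m)      ∎
    where open ℤ.≤-Reasoning

Near-mono : ∀ {m k u v} → m ≤ k → Near m u v → Near k u v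
Near-mono {u = u} {v} m≤k (u≤v+m , v≤u+m) =
  ℤ.≤-trans u≤v+m (ℤ.+-monoʳ-≤ v (+≤+ m≤k)) , ℤ.≤-trans v≤u+m (ℤ.+-monoʳ-≤ u (+≤+ m≤k))

Near-+1 : ∀ u → Near 1 u (u +ᶻ 1ℤ)
Near-+1 u = ℤ.≤-trans (ℤ.i≤i+j u 1ℤ) (ℤ.i≤i+j (u +ᶻ 1ℤ) 1ℤ) , ℤ.≤-refl

Near-−1 : ∀ u → Near 1 u (u -ᶻ 1ℤ)
Near-−1 u = subst (λ x → Near 1 x (u -ᶻ 1ℤ)) (cancel u) (Near-sym (Near-+1 (u -ᶻ 1ℤ)))
  where
  cancel : ∀ u → u -ᶻ 1ℤ +ᶻ 1ℤ ≡ u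
  cancel = solve-∀

Within : ℤ → ℕ → ℤ → Set
Within a k u = a ≤ᶻ u × u ≤ᶻ a +ᶻ + k

≤-resp-difference : ∀ {u v u′ v′} → v -ᶻ u ≡ v′ -ᶻ u′ → u ≤ᶻ v → u′ ≤ᶻ v′
≤-resp-difference eq u≤v = ℤ.0≤i-j⇒j≤i (subst (0ℤ ≤ᶻ_) eq (ℤ.i≤j⇒0≤j-i u≤v))

Within⇒+offset : ∀ {a k x} → Within a k x → ∃ λ t → t ≤ k × x ≡ a +ᶻ + t
Within⇒+offset {a} {k} {x} (a≤x , x≤a+k) = ∣ a -ᶻ x ∣ , t≤k , sym a+t≡x
  where
  a+t≡x : a +ᶻ + ∣ a -ᶻ x ∣ ≡ x
  a+t≡x = trans (cong (a +ᶻ_) (ℤ.∣-∣-≤ a≤x)) (a+[x-a] a x)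
    where a+[x-a] : ∀ a x → a +ᶻ (x -ᶻ a) ≡ x
          a+[x-a] = solve-∀
  t≤k : ∣ a -ᶻ x ∣ ≤ k
  t≤k = ℤ.drop‿+≤+ (≤-resp-difference (cancel a (+ ∣ a -ᶻ x ∣) (+ k)) (subst (_≤ᶻ a +ᶻ + k) (sym a+t≡x) x≤a+k))
    where cancel : ∀ a t k → a +ᶻ k -ᶻ (a +ᶻ t) ≡ k -ᶻ t
          cancel = solve-∀

Near-pairwise⇒Within : ∀ {A : Set} (f : A → ℤ) {k} p ps
  → (∀ {x y} → x ∈ p ∷ ps → y ∈ p ∷ ps → Near k (f x) (f y))
  → ∃ λ a → ∀ {z} → z ∈ p ∷ ps → Within a k (f z)
Near-pairwise⇒Within f p ps near = f q , λ z∈ → lower z∈ , proj₂ (near q∈ z∈)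
  where
  q = argmin f p ps
  q∈ : q ∈ p ∷ ps
  q∈ = argmin-all f (here refl) (All.tabulate there)
  lower : ∀ {z} → z ∈ p ∷ ps → f q ≤ᶻ f z
  lower (here refl) = f[argmin]≤f[⊤] {f = f} p ps
  lower (there z∈)  = All.lookup (f[argmin]≤f[xs] {f = f} p ps) z∈

NonExpanding : (Point → ℤ) → Set
NonExpanding f = ∀ {p q} → Adj p q → Near 1 (f p) (f q)

NonExpanding⇒Near : ∀ {f} → NonExpanding f → ∀ {k p q} → DistLe k p q → Near k (f p) (f q)
NonExpanding⇒Near f-ne DistLe.here         = Near-refl _
NonExpanding⇒Near f-ne (DistLe.step pq qt) = Near-trans (f-ne pq) (NonExpanding⇒Near f-ne qt)

proj₁-nonExpanding : NonExpanding proj₁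
proj₁-nonExpanding Adj.e  = Near-+1 _
proj₁-nonExpanding Adj.w  = Near-−1 _
proj₁-nonExpanding Adj.n  = Near-refl _
proj₁-nonExpanding Adj.s  = Near-refl _
proj₁-nonExpanding Adj.ne = Near-+1 _
proj₁-nonExpanding Adj.sw = Near-−1 _

proj₂-nonExpanding : NonExpanding proj₂
proj₂-nonExpanding Adj.e  = Near-refl _
proj₂-nonExpanding Adj.w  = Near-refl _
proj₂-nonExpanding Adj.n  = Near-+1 _
proj₂-nonExpanding Adj.s  = Near-−1 _
proj₂-nonExpanding Adj.ne = Near-+1 _
proj₂-nonExpanding Adj.sw = Near-−1 _

skew : Point → ℤ
skew (i , j) = i -ᶻ j

skew-nonExpanding : NonExpanding skew
skew-nonExpanding (Adj.e  {i} {j}) = subst (Near 1 _) (skew-step i j) (Near-+1 _)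
  where skew-step : ∀ i j → i -ᶻ j +ᶻ 1ℤ ≡ i +ᶻ 1ℤ -ᶻ j
        skew-step = solve-∀
skew-nonExpanding (Adj.w  {i} {j}) = subst (Near 1 _) (skew-step i j) (Near-−1 _)
  where skew-step : ∀ i j → i -ᶻ j -ᶻ 1ℤ ≡ i -ᶻ 1ℤ -ᶻ j
        skew-step = solve-∀
skew-nonExpanding (Adj.n  {i} {j}) = subst (Near 1 _) (skew-step i j) (Near-−1 _)
  where skew-step : ∀ i j → i -ᶻ j -ᶻ 1ℤ ≡ i -ᶻ (j +ᶻ 1ℤ)
        skew-step = solve-∀
skew-nonExpanding (Adj.s  {i} {j}) = subst (Near 1 _) (skew-step i j) (Near-+1 _)
  where skew-step : ∀ i j → i -ᶻ j +ᶻ 1ℤ ≡ i -ᶻ (j -ᶻ 1ℤ)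
        skew-step = solve-∀
skew-nonExpanding (Adj.ne {i} {j}) = subst (Near 1 _) (skew-step i j) (Near-refl _)
  where skew-step : ∀ i j → i -ᶻ j ≡ i +ᶻ 1ℤ -ᶻ (j +ᶻ 1ℤ)
        skew-step = solve-∀
skew-nonExpanding (Adj.sw {i} {j}) = subst (Near 1 _) (skew-step i j) (Near-refl _)
  where skew-step : ∀ i j → i -ᶻ j ≡ i -ᶻ 1ℤ -ᶻ (j -ᶻ 1ℤ)
        skew-step = solve-∀

Meets⇒Near : ∀ {r ℓ A f c c′} → Anticode r A → NonExpanding f → Meets A ℓ c → Meets A ℓ c′
  → Near (r + 2 * ℓ) (f c) (f c′)
Meets⇒Near {r} {ℓ} anti f-ne (a , a∈A , ca≤ℓ) (a′ , a′∈A , c′a′≤ℓ) =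
  Near-mono (≤-reflexive (regroup r ℓ))
    (Near-trans (NonExpanding⇒Near f-ne ca≤ℓ)
      (Near-trans (NonExpanding⇒Near f-ne (anti a∈A a′∈A)) (Near-sym (NonExpanding⇒Near f-ne c′a′≤ℓ))))
  where regroup : ∀ r ℓ → ℓ + (r + ℓ) ≡ r + 2 * ℓ
        regroup = ℕ-Solver.solve-∀

Hexagon : ℤ → ℤ → ℤ → ℕ → Pred Point 0ℓ
Hexagon a b c D p = Within a D (proj₁ p) × Within b D (proj₂ p) × Within c D (skew p)

NonExpanding-bounded⇒Hexagon : ∀ {D} p ps
  → (∀ {f} → NonExpanding f → ∀ {x y} → x ∈ p ∷ ps → y ∈ p ∷ ps → Near D (f x) (f y))
  → ∃ λ a → ∃ λ b → ∃ λ c → ∀ {z} → z ∈ p ∷ ps → Hexagon a b c D z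
NonExpanding-bounded⇒Hexagon p ps near
  with Near-pairwise⇒Within proj₁ p ps (near proj₁-nonExpanding)
     | Near-pairwise⇒Within proj₂ p ps (near proj₂-nonExpanding)
     | Near-pairwise⇒Within skew p ps (near skew-nonExpanding)
... | a , in₁ | b , in₂ | c , in₃ = a , b , c , λ z∈ → in₁ z∈ , in₂ z∈ , in₃ z∈

∑≤ : ℕ → (ℕ → ℕ) → ℕ
∑≤ zero    f = f 0
∑≤ (suc d) f = ∑≤ d f + f (suc d)

syntax ∑≤ d (λ t → e) = ∑[ t ≤ d ] e

∑-cong : ∀ d {f g : ℕ → ℕ} → (∀ {t} → t ≤ d → f t ≡ g t) → ∑≤ d f ≡ ∑≤ d g
∑-cong zero    f≡g = f≡g z≤n
∑-cong (suc d) f≡g = cong₂ _+_ (∑-cong d (f≡g ∘ m≤n⇒m≤1+n)) (f≡g ≤-refl)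

∑-mono-≤ : ∀ d {f g : ℕ → ℕ} → (∀ {t} → t ≤ d → f t ≤ g t) → ∑≤ d f ≤ ∑≤ d g
∑-mono-≤ zero    f≤g = f≤g z≤n
∑-mono-≤ (suc d) f≤g = +-mono-≤ (∑-mono-≤ d (f≤g ∘ m≤n⇒m≤1+n)) (f≤g ≤-refl)

∑-distrib-+ : ∀ d (f g : ℕ → ℕ) → ∑[ t ≤ d ] (f t + g t) ≡ ∑≤ d f + ∑≤ d g
∑-distrib-+ zero    f g = refl
∑-distrib-+ (suc d) f g = begin
  ∑[ t ≤ d ] (f t + g t) + (f (suc d) + g (suc d))  ≡⟨ cong (_+ (f (suc d) + g (suc d))) (∑-distrib-+ d f g) ⟩
  ∑≤ d f + ∑≤ d g + (f (suc d) + g (suc d))          ≡⟨ +-interchange (∑≤ d f) (∑≤ d g) _ _ ⟩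
  ∑≤ d f + f (suc d) + (∑≤ d g + g (suc d))          ∎
  where open ≡-Reasoning

∑-const : ∀ d c → ∑[ t ≤ d ] c ≡ suc d * c
∑-const zero    c = sym (+-identityʳ c)
∑-const (suc d) c = trans (cong (_+ c) (∑-const d c)) (+-comm (suc d * c) c)

∑-unconsˡ : ∀ d (f : ℕ → ℕ) → ∑≤ (suc d) f ≡ f 0 + ∑[ t ≤ d ] f (suc t)
∑-unconsˡ zero    f = refl
∑-unconsˡ (suc d) f = trans (cong (_+ f (2 + d)) (∑-unconsˡ d f)) (+-assoc (f 0) _ _)

∑-reverse : ∀ d (f : ℕ → ℕ) → ∑[ t ≤ d ] f (d ∸ t) ≡ ∑≤ d f
∑-reverse zero    f = refl
∑-reverse (suc d) f = begin
  ∑[ t ≤ d ] f (suc d ∸ t) + f (d ∸ d)   ≡⟨ cong₂ _+_ (∑-cong d (cong f ∘ +-∸-assoc 1)) (cong f (n∸n≡0 d)) ⟩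
  ∑[ t ≤ d ] f (suc (d ∸ t)) + f 0       ≡⟨ cong (_+ f 0) (∑-reverse d (f ∘ suc)) ⟩
  ∑[ t ≤ d ] f (suc t) + f 0             ≡⟨ +-comm _ (f 0) ⟩
  f 0 + ∑[ t ≤ d ] f (suc t)             ≡⟨ ∑-unconsˡ d f ⟨
  ∑≤ (suc d) f                           ∎
  where open ≡-Reasoning

-- |2t − D| for t ≤ D; comparing t with D ∸ t makes gap D t ≤ D immediate.
gap : ℕ → ℕ → ℕ
gap D t = ∣ t ⊖ (D ∸ t) ∣

gap≤ : ∀ {D t} → t ≤ D → gap D t ≤ D
gap≤ {D} {t} t≤D = ≤-trans (ℤ.∣m⊝n∣≤m⊔n t (D ∸ t)) (⊔-lub t≤D (m∸n≤m D t))

gap≤∣t-o∣+∣D∸t-o∣ : ∀ D t o → gap D t ≤ ∣ + t -ᶻ o ∣ + ∣ + (D ∸ t) -ᶻ o ∣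
gap≤∣t-o∣+∣D∸t-o∣ D t o = begin
  ∣ t ⊖ (D ∸ t) ∣                              ≡⟨ cong ∣_∣ (ℤ.m-n≡m⊖n t (D ∸ t)) ⟨
  ∣ + t -ᶻ + (D ∸ t) ∣                         ≡⟨ cong ∣_∣ (cancel (+ t) (+ (D ∸ t)) o) ⟩
  ∣ (+ t -ᶻ o) -ᶻ (+ (D ∸ t) -ᶻ o) ∣           ≤⟨ ℤ.∣i-j∣≤∣i∣+∣j∣ (+ t -ᶻ o) (+ (D ∸ t) -ᶻ o) ⟩
  ∣ + t -ᶻ o ∣ + ∣ + (D ∸ t) -ᶻ o ∣            ∎
  where
  open ≤-Reasoning
  cancel : ∀ x y o → x -ᶻ y ≡ (x -ᶻ o) -ᶻ (y -ᶻ o)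
  cancel = solve-∀

gap-step : ∀ D → ∑[ t ≤ 2 + D ] gap (2 + D) t ≡ 2 + D + ∑[ t ≤ D ] gap D t + (2 + D)
gap-step D = begin
  ∑[ t ≤ 2 + D ] gap (2 + D) t                                ≡⟨ cong (_+ gap (2 + D) (2 + D)) (∑-unconsˡ D (gap (2 + D))) ⟩
  2 + D + ∑[ t ≤ D ] gap (2 + D) (suc t) + gap (2 + D) (2 + D) ≡⟨ cong₂ (λ x y → 2 + D + x + y) (∑-cong D inner) last ⟩
  2 + D + ∑[ t ≤ D ] gap D t + (2 + D)                         ∎
  where
  open ≡-Reasoning
  inner : ∀ {t} → t ≤ D → gap (2 + D) (suc t) ≡ gap D t
  inner {t} t≤D = trans (cong (λ x → ∣ suc t ⊖ x ∣) (+-∸-assoc 1 t≤D)) (cong ∣_∣ (ℤ.[1+m]⊖[1+n]≡m⊖n t (D ∸ t)))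
  last : gap (2 + D) (2 + D) ≡ 2 + D
  last = cong (λ x → ∣ 2 + D ⊖ x ∣) (n∸n≡0 D)

D²≤2∑gap : ∀ D → D * D ≤ 2 * ∑[ t ≤ D ] gap D t
D²≤2∑gap zero          = z≤n
D²≤2∑gap (suc zero)    = s≤s z≤n
D²≤2∑gap (suc (suc D)) = begin
  (2 + D) * (2 + D)                           ≡⟨ expand D ⟩
  D * D + (4 * D + 4)                         ≤⟨ +-mono-≤ (D²≤2∑gap D) (m≤m+n (4 * D + 4) 4) ⟩
  2 * G + (4 * D + 4 + 4)                     ≡⟨ regroup D G ⟩
  2 * (2 + D + G + (2 + D))                   ≡⟨ cong (2 *_) (gap-step D) ⟨
  2 * ∑[ t ≤ 2 + D ] gap (2 + D) t            ∎
  where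
  open ≤-Reasoning
  G = ∑[ t ≤ D ] gap D t
  expand : ∀ D → (2 + D) * (2 + D) ≡ D * D + (4 * D + 4)
  expand = ℕ-Solver.solve-∀
  regroup : ∀ D G → 2 * G + (4 * D + 4 + 4) ≡ 2 * (2 + D + G + (2 + D))
  regroup = ℕ-Solver.solve-∀

m∸a+m∸b+e≤m+m : ∀ {m} a b {e} → e ≤ a + b → e ≤ m → m ∸ a + (m ∸ b) + e ≤ m + m
m∸a+m∸b+e≤m+m {m} a b {e} e≤a+b e≤m with a ≤? m | b ≤? m
... | yes a≤m | yes b≤m = begin
  m ∸ a + (m ∸ b) + e          ≤⟨ +-monoʳ-≤ (m ∸ a + (m ∸ b)) e≤a+b ⟩
  m ∸ a + (m ∸ b) + (a + b)    ≡⟨ +-interchange (m ∸ a) (m ∸ b) a b ⟩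
  m ∸ a + a + (m ∸ b + b)      ≡⟨ cong₂ _+_ (m∸n+n≡m a≤m) (m∸n+n≡m b≤m) ⟩
  m + m                        ∎
  where open ≤-Reasoning
... | no a≰m | _ = begin
  m ∸ a + (m ∸ b) + e          ≡⟨ cong (λ x → x + (m ∸ b) + e) (m≤n⇒m∸n≡0 (≰⇒≥ a≰m)) ⟩
  m ∸ b + e                    ≤⟨ +-mono-≤ (m∸n≤m m b) e≤m ⟩
  m + m                        ∎
  where open ≤-Reasoning
... | yes _ | no b≰m = begin
  m ∸ a + (m ∸ b) + e          ≡⟨ cong (λ x → m ∸ a + x + e) (m≤n⇒m∸n≡0 (≰⇒≥ b≰m)) ⟩
  m ∸ a + 0 + e                ≤⟨ +-mono-≤ (≤-trans (≤-reflexive (+-identityʳ _)) (m∸n≤m m a)) e≤m ⟩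
  m + m                        ∎
  where open ≤-Reasoning

∑-column-bound : ∀ D o → 4 * ∑[ t ≤ D ] (suc D ∸ ∣ + t -ᶻ o ∣) ≤ 3 * (D * D) + 8 * D + 4
∑-column-bound D o = +-cancelʳ-≤ (D * D) (4 * H) _ (begin
  4 * H + D * D                              ≤⟨ +-monoʳ-≤ (4 * H) (D²≤2∑gap D) ⟩
  4 * H + 2 * G                              ≡⟨ double H G ⟩
  2 * (H + H + G)                            ≤⟨ *-monoʳ-≤ 2 2H+G≤2M² ⟩
  2 * (M * (M + M))                          ≡⟨ expand D ⟩
  3 * (D * D) + 8 * D + 4 + D * D            ∎)
  where
  open ≤-Reasoning
  M = suc D
  h : ℕ → ℕ
  h t = M ∸ ∣ + t -ᶻ o ∣
  H = ∑≤ D h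
  G = ∑≤ D (gap D)
  pair : ∀ {t} → t ≤ D → h t + h (D ∸ t) + gap D t ≤ M + M
  pair {t} t≤D = m∸a+m∸b+e≤m+m ∣ + t -ᶻ o ∣ ∣ + (D ∸ t) -ᶻ o ∣ (gap≤∣t-o∣+∣D∸t-o∣ D t o) (m≤n⇒m≤1+n (gap≤ t≤D))
  2H+G≤2M² : H + H + G ≤ M * (M + M)
  2H+G≤2M² = begin
    H + H + G                                ≡⟨ cong (λ x → H + x + G) (∑-reverse D h) ⟨
    H + ∑[ t ≤ D ] h (D ∸ t) + G             ≡⟨ cong (_+ G) (∑-distrib-+ D h (h ∘ (D ∸_))) ⟨
    ∑[ t ≤ D ] (h t + h (D ∸ t)) + G         ≡⟨ ∑-distrib-+ D (λ t → h t + h (D ∸ t)) (gap D) ⟨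
    ∑[ t ≤ D ] (h t + h (D ∸ t) + gap D t)   ≤⟨ ∑-mono-≤ D pair ⟩
    ∑[ t ≤ D ] (M + M)                       ≡⟨ ∑-const D (M + M) ⟩
    M * (M + M)                              ∎
  double : ∀ H G → 4 * H + 2 * G ≡ 2 * (H + H + G)
  double = ℕ-Solver.solve-∀
  expand : ∀ D → 2 * (suc D * (suc D + suc D)) ≡ 3 * (D * D) + 8 * D + 4 + D * D
  expand = ℕ-Solver.solve-∀

Unique-⊆⇒length≤ : ∀ {A : Set} {xs ys : List A} → Unique xs → xs ⊆ ys → length xs ≤ length ys
Unique-⊆⇒length≤ {xs = []}     _              _    = z≤n
Unique-⊆⇒length≤ {xs = x ∷ xs} {ys} (x∉xs ∷ !xs) x∷xs⊆ys =
  subst (suc (length xs) ≤_) (sym (length-removeAt′ ys _))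
    (s≤s (Unique-⊆⇒length≤ !xs λ z∈xs → ∈-─ x∈ys (x∷xs⊆ys (there z∈xs)) (All.lookup x∉xs z∈xs ∘ sym)))
  where
  x∈ys = x∷xs⊆ys (here refl)
  ∈-─ : ∀ {ys z} (x∈ys : x ∈ ys) → z ∈ ys → z ≢ x → z ∈ (ys ─ x∈ys)
  ∈-─ (here refl)  (here refl)  z≢x = contradiction refl z≢x
  ∈-─ (here refl)  (there z∈ys) _   = z∈ys
  ∈-─ (there _)    (here refl)  _   = here refl
  ∈-─ (there x∈ys) (there z∈ys) z≢x = there (∈-─ x∈ys z∈ys z≢x)

concatUpTo : ∀ {A : Set} → (ℕ → List A) → ℕ → List A
concatUpTo F zero    = F 0
concatUpTo F (suc d) = concatUpTo F d ++ F (suc d)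

length-concatUpTo : ∀ {A : Set} (F : ℕ → List A) d → length (concatUpTo F d) ≡ ∑[ t ≤ d ] length (F t)
length-concatUpTo F zero    = refl
length-concatUpTo F (suc d) = trans (length-++ (concatUpTo F d)) (cong (_+ length (F (suc d))) (length-concatUpTo F d))

∈-concatUpTo : ∀ {A : Set} {F : ℕ → List A} {d t x} → t ≤ d → x ∈ F t → x ∈ concatUpTo F d
∈-concatUpTo {d = zero}  z≤n   x∈ = x∈
∈-concatUpTo {F = F} {d = suc d} t≤1+d x∈ with m≤n⇒m<n∨m≡n t≤1+d
... | inj₁ (s≤s t≤d) = ∈-++⁺ˡ (∈-concatUpTo t≤d x∈)
... | inj₂ refl      = ∈-++⁺ʳ (concatUpTo F d) x∈

-- The naturals j ≤ D with u ≤ j ≤ u + D.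
window : ℤ → ℕ → List ℕ
window (+ p)     D = map (λ i → p + i) (upTo (suc D ∸ p))
window -[1+ q ] D = upTo (D ∸ q)

length-window : ∀ u D → length (window u D) ≡ suc D ∸ ∣ u ∣
length-window (+ p)     D = trans (length-map (λ i → p + i) (upTo (suc D ∸ p))) (length-upTo (suc D ∸ p))
length-window -[1+ q ] D = length-upTo (D ∸ q)

∈-window : ∀ {u j D} → u ≤ᶻ + j → + j ≤ᶻ u +ᶻ + D → j ≤ D → j ∈ window u D
∈-window {+ p} {j} {D} (+≤+ p≤j) _ j≤D =
  subst (_∈ window (+ p) D) (m+[n∸m]≡n p≤j) (∈-map⁺ (λ i → p + i) (∈-upTo⁺ j∸p<1+D∸p))
  where
  j∸p<1+D∸p : j ∸ p < suc D ∸ p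
  j∸p<1+D∸p = subst (suc (j ∸ p) ≤_) (sym (+-∸-assoc 1 (≤-trans p≤j j≤D))) (s≤s (∸-monoˡ-≤ p j≤D))
∈-window { -[1+ q ]} {j} {D} _ j≤D-1-q _ = ∈-upTo⁺ (m+n≤o⇒m≤o∸n (suc j) (subst (_≤ D) (+-suc j q) j+1+q≤D))
  where
  j+1+q≤D : j + suc q ≤ D
  j+1+q≤D = ℤ.drop‿+≤+ (≤-resp-difference (cancel (+ suc q) (+ D) (+ j)) j≤D-1-q)
    where cancel : ∀ q D j → (-ᶻ q +ᶻ D) -ᶻ j ≡ D -ᶻ (j +ᶻ q)
          cancel = solve-∀

column : ℤ → ℤ → ℤ → ℕ → ℕ → List Point
column a b o D t = map (λ j → (a +ᶻ + t , b +ᶻ + j)) (window (+ t -ᶻ o) D)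

length-column : ∀ a b o D t → length (column a b o D t) ≡ suc D ∸ ∣ + t -ᶻ o ∣
length-column a b o D t = trans (length-map _ (window (+ t -ᶻ o) D)) (length-window (+ t -ᶻ o) D)

-- With x = a + t and y = b + j, the condition c ≤ x − y ≤ c + D reads t − o ≤ j ≤ t − o + D.
hexagon : ℤ → ℤ → ℤ → ℕ → List Point
hexagon a b c D = concatUpTo (column a b (c +ᶻ + D -ᶻ (a -ᶻ b)) D) D

∈-hexagon : ∀ {a b c D} p → Hexagon a b c D p → p ∈ hexagon a b c D
∈-hexagon {a} {b} {c} {D} (x , y) (x-in , y-in , (c≤x-y , x-y≤c+D)) with Within⇒+offset x-in | Within⇒+offset y-in
... | t , t≤D , refl | j , j≤D , refl =
  ∈-concatUpTo t≤D (∈-map⁺ (λ j → (a +ᶻ + t , b +ᶻ + j)) (∈-window lower upper j≤D))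
  where
  o = c +ᶻ + D -ᶻ (a -ᶻ b)
  lower : + t -ᶻ o ≤ᶻ + j
  lower = ≤-resp-difference (regroup a b c (+ t) (+ j) (+ D)) x-y≤c+D
    where regroup : ∀ a b c t j D → c +ᶻ D -ᶻ (a +ᶻ t -ᶻ (b +ᶻ j)) ≡ j -ᶻ (t -ᶻ (c +ᶻ D -ᶻ (a -ᶻ b)))
          regroup = solve-∀
  upper : + j ≤ᶻ + t -ᶻ o +ᶻ + D
  upper = ≤-resp-difference (regroup a b c (+ t) (+ j) (+ D)) c≤x-y
    where regroup : ∀ a b c t j D → a +ᶻ t -ᶻ (b +ᶻ j) -ᶻ c ≡ t -ᶻ (c +ᶻ D -ᶻ (a -ᶻ b)) +ᶻ D -ᶻ j
          regroup = solve-∀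

4*length-hexagon≤ : ∀ a b c D → 4 * length (hexagon a b c D) ≤ 3 * (D * D) + 8 * D + 4
4*length-hexagon≤ a b c D = begin
  4 * length (hexagon a b c D)                                 ≡⟨ cong (4 *_) (length-concatUpTo _ D) ⟩
  4 * ∑[ t ≤ D ] length (column a b o D t)                     ≡⟨ cong (4 *_) (∑-cong D λ {t} _ → length-column a b o D t) ⟩
  4 * ∑[ t ≤ D ] (suc D ∸ ∣ + t -ᶻ o ∣)                         ≤⟨ ∑-column-bound D o ⟩
  3 * (D * D) + 8 * D + 4                                      ∎
  where
  open ≤-Reasoning
  o = c +ᶻ + D -ᶻ (a -ᶻ b)

Unique-Hexagon⇒4*length≤ : ∀ {a b c D cs} → Unique cs → (∀ {p} → p ∈ cs → Hexagon a b c D p)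
  → 4 * length cs ≤ 3 * (D * D) + 8 * D + 4
Unique-Hexagon⇒4*length≤ {a} {b} {c} {D} !cs cs⊆hex =
  ≤-trans (*-monoʳ-≤ 4 (Unique-⊆⇒length≤ !cs (λ {p} p∈ → ∈-hexagon p (cs⊆hex p∈)))) (4*length-hexagon≤ a b c D)

Meets⇒4*length≤ : ∀ {r ℓ A cs} → Anticode r A → Unique cs → All (Meets A ℓ) cs
  → 4 * length cs ≤ 3 * ((r + 2 * ℓ) * (r + 2 * ℓ)) + 8 * (r + 2 * ℓ) + 4
Meets⇒4*length≤ {cs = []}     _    _   _     = z≤n
Meets⇒4*length≤ {cs = p ∷ ps} anti !cs meets
  with NonExpanding-bounded⇒Hexagon p ps
         (λ f-ne x∈ y∈ → Meets⇒Near anti f-ne (All.lookup meets x∈) (All.lookup meets y∈))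
... | _ , _ , _ , in-hexagon = Unique-Hexagon⇒4*length≤ !cs in-hexagon

8*[r+2ℓ]+4≤28*r : ∀ {r ℓ} → 1 ≤ ℓ → ℓ ≤ r → 8 * (r + 2 * ℓ) + 4 ≤ 28 * r
8*[r+2ℓ]+4≤28*r {r} {ℓ} 1≤ℓ ℓ≤r = begin
  8 * (r + 2 * ℓ) + 4      ≤⟨ +-mono-≤ (*-monoʳ-≤ 8 (+-monoʳ-≤ r (*-monoʳ-≤ 2 ℓ≤r))) (*-monoʳ-≤ 4 (≤-trans 1≤ℓ ℓ≤r)) ⟩
  8 * (r + 2 * r) + 4 * r  ≡⟨ collect r ⟩
  28 * r                   ∎
  where
  open ≤-Reasoning
  collect : ∀ r → 8 * (r + 2 * r) + 4 * r ≡ 28 * r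
  collect = ℕ-Solver.solve-∀

lemma3 : Σ ℕ λ C → (r ℓ : ℕ) (A : Pred Point 0ℓ) → Anticode r A → 1 ≤ ℓ → ℓ ≤ r
    → (cs : List Point) → Unique cs → All (Meets A ℓ) cs
    → 4 * length cs ≤ 3 * (r + 2 * ℓ) ^ 2 + 4 * C * r
lemma3 = 7 , λ r ℓ A anti 1≤ℓ ℓ≤r cs !cs meets →
  let D = r + 2 * ℓ in begin
    4 * length cs               ≤⟨ Meets⇒4*length≤ anti !cs meets ⟩
    3 * (D * D) + 8 * D + 4     ≡⟨ +-assoc (3 * (D * D)) (8 * D) 4 ⟩
    3 * (D * D) + (8 * D + 4)   ≤⟨ +-mono-≤ (≤-reflexive (cong (λ x → 3 * (D * x)) (sym (*-identityʳ D)))) (8*[r+2ℓ]+4≤28*r 1≤ℓ ℓ≤r) ⟩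
    3 * D ^ 2 + 28 * r          ∎
  where open ≤-Reasoning
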